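{- Suppose $0.01\geq \delta\gg_{\mathrm{poly}}\gamma\gg_{\mathrm{poly}} n^{ -1}$. Every $(\gamma,\delta,n)$-regular balanced bipartite graph $G$ on $2n$ vertices is contained in a $d$-regular balanced bipartite graph $G'$ with parts of size at most $(1+9\gamma)n$, where $d=\lceil(1+5\gamma)\delta n\rceil$, such that every edge of $G'$ not in $G$ has an endpoint in $V(G')\setminus V(G)$.
   Context: A balanced bipartite graph with parts $X,Y$ is $(\gamma,\delta,n)$-regular if $|X|=|Y|=(1\pm\gamma)n$ and every vertex has degree $(1\pm\gamma)\delta n$ (here $a=b\pm c$ means $|a-b|\leq c$). Notation: for $C\geq1$ and $x,y\in(0,1]$, $x\ll_C y$ means $x\leq y^C/C$; a hypothesis chain $a\gg_{\mathrm{poly}}b\gg_{\mathrm{poly}}c$ means there is an absolute constant $C$ such that the conclusion holds whenever each consecutive relation holds with $\ll_C$.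
   Formalization: The parameters δ and γ are rational. -}

module Defs where

open import Data.Nat as ℕ using (ℕ; zero; suc)
open import Data.Integer as ℤ using (ℤ; +_)
open import Data.Rational using (ℚ; _/_; _*_; _-_; _+_; ∣_∣; _≤_; 1ℚ)
open import Data.Fin using (Fin; zero; suc)
open import Data.Bool using (Bool; true; false)
open import Data.Product using (Σ; ∃; _×_; _,_)
open import Data.Sum using (_⊎_)
open import Relation.Binary.PropositionalEquality using (_≡_)
open import Relation.Nullary using (¬_)
open import Function.Definitions using (Injective)

ℕ→ℚ : ℕ → ℚ
ℕ→ℚ k = + k / 1

_^ℚ_ : ℚ → ℕ → ℚ
q ^ℚ zero = 1ℚ
q ^ℚ suc k = q * (q ^ℚ k)

count : ∀ {n} → (Fin n → Bool) → ℕ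
count {zero} f = 0
count {suc n} f with f zero
... | true  = suc (count (λ i → f (suc i)))
... | false = count (λ i → f (suc i))

BipGraph : ℕ → ℕ → Set
BipGraph a b = Fin a → Fin b → Bool

degX : ∀ {a b} → BipGraph a b → Fin a → ℕ
degX G x = count (λ y → G x y)

degY : ∀ {a b} → BipGraph a b → Fin b → ℕ
degY G y = count (λ x → G x y)

_≈_±_ : ℚ → ℚ → ℚ → Set
a ≈ b ± c = ∣ a - b ∣ ≤ c

IsRegularGDN : ℚ → ℚ → ℕ → ∀ {a b} → BipGraph a b → Set
IsRegularGDN γ δ n {a} {b} G =
  (a ≡ b)
  × (ℕ→ℚ a ≈ ℕ→ℚ n ± (γ * ℕ→ℚ n))
  × (ℕ→ℚ b ≈ ℕ→ℚ n ± (γ * ℕ→ℚ n))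
  × (∀ x → ℕ→ℚ (degX G x) ≈ δ * ℕ→ℚ n ± (γ * (δ * ℕ→ℚ n)))
  × (∀ y → ℕ→ℚ (degY G y) ≈ δ * ℕ→ℚ n ± (γ * (δ * ℕ→ℚ n)))

IsDRegular : ℕ → ∀ {a b} → BipGraph a b → Set
IsDRegular d G = (∀ x → degX G x ≡ d) × (∀ y → degY G y ≡ d)

_≪[_]_ : ℚ → ℕ → ℚ → Set
x ≪[ C ] y = ℕ→ℚ C * x ≤ y ^ℚ C

-- G (parts Fin n, Fin n) is contained in G' (parts Fin m, Fin m) via the
-- part-preserving injections f : X → X', g : Y → Y', and every edge of G'
-- not in (the image of) G has an endpoint in V(G') ∖ V(G).
ContainedWithNewEdgesOutside : ∀ {n m} → BipGraph n n → BipGraph m m →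
                               (Fin n → Fin m) → (Fin n → Fin m) → Set
ContainedWithNewEdgesOutside {n} {m} G G' f g =
  Injective _≡_ _≡_ f × Injective _≡_ _≡_ g
  × (∀ x y → G x y ≡ true → G' (f x) (g y) ≡ true)
  × (∀ x' y' → G' x' y' ≡ true →
       ¬ (Σ (Fin n) λ x → Σ (Fin n) λ y → (f x ≡ x') × (g y ≡ y') × (G x y ≡ true)) →
       (¬ (Σ (Fin n) λ x → f x ≡ x')) ⊎ (¬ (Σ (Fin n) λ y → g y ≡ y')))

{-# OPTIONS --safe #-}
-- Put A = δn, B = γδn and d = ⌈A + 5B⌉. Every vertex of G misses between 4B and 7B of its d
-- edges; by double counting the deficits on both sides have the same total R, and we add
-- k = ⌈R/d⌉ ≤ 9γn new vertices to each side. Laying the deficits of the old vertices of X side by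
-- side on the slots 0, …, R - 1 and joining each old vertex to the new vertices indexed by its
-- slots mod k gives it its missing edges, all distinct because no deficit exceeds k; the same is
-- done for Y. A new vertex then has at least d - k and at most d old neighbours, and it is
-- completed inside the new k × k block by continuing the slot sequence through R, …, kd - 1.
-- The hypotheses on δ, γ and n supply the slack for "every deficit is at most k" and for
-- k (d - k) ≤ R, which follows from d ≤ k².
module Submission where

open import Defs
open import Data.Bool using (Bool; true; false)
open import Data.Empty using (⊥-elim)
open import Data.Fin using (Fin; zero; suc; toℕ; _↑ˡ_; _↑ʳ_; splitAt)
open import Data.Fin.Properties using (toℕ<n; splitAt-↑ˡ; splitAt-↑ʳ; splitAt⁻¹-↑ˡ; ↑ˡ-injective)
open import Data.Nat using (ℕ; zero; suc; NonZero; _≥_; z≤n; s≤s)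
open import Data.Product using (Σ; _×_; _,_; proj₁; proj₂)
open import Data.Sum using (_⊎_; inj₁; inj₂)
open import Function using (_∘_)
open import Relation.Binary.PropositionalEquality
open import Relation.Nullary using (¬_; does; yes; no)
open import Relation.Nullary.Decidable using (dec-true; dec-false)

module Counting where
  open import Data.Nat using (_+_; _*_; _∸_; _≤_)
  open import Data.Nat.Properties
  open import Algebra.Properties.Semiring.Sum +-*-semiring public
    using (sum; sum-cong-≗; ∑-distrib-+; ∑-comm; *-distribˡ-sum)

  indicator : Bool → ℕ
  indicator true  = 1
  indicator false = 0

  sum-const : ∀ n c → sum {n} (λ _ → c) ≡ n * c
  sum-const zero    c = refl
  sum-const (suc n) c = cong (c +_) (sum-const n c)

  sum-mono-≤ : ∀ {n} {f g : Fin n → ℕ} → (∀ i → f i ≤ g i) → sum f ≤ sum g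
  sum-mono-≤ {zero}  f≤g = z≤n
  sum-mono-≤ {suc n} f≤g = +-mono-≤ (f≤g zero) (sum-mono-≤ (f≤g ∘ suc))

  sum-↑ : ∀ m {n} (f : Fin (m + n) → ℕ) → sum f ≡ sum (f ∘ (_↑ˡ n)) + sum (f ∘ (m ↑ʳ_))
  sum-↑ zero    f = refl
  sum-↑ (suc m) f = trans (cong (f zero +_) (sum-↑ m (f ∘ suc))) (sym (+-assoc (f zero) _ _))

  ∑[c∸f]+∑f≡n*c : ∀ {n} (f : Fin n → ℕ) c → (∀ i → f i ≤ c) → sum (λ i → c ∸ f i) + sum f ≡ n * c
  ∑[c∸f]+∑f≡n*c {n} f c f≤c = begin
    sum (λ i → c ∸ f i) + sum f  ≡⟨ ∑-distrib-+ (λ i → c ∸ f i) f ⟨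
    sum (λ i → c ∸ f i + f i)    ≡⟨ sum-cong-≗ (λ i → m∸n+n≡m (f≤c i)) ⟩
    sum {n} (λ _ → c)            ≡⟨ sum-const n c ⟩
    n * c                        ∎
    where open ≡-Reasoning

  count≡sum : ∀ {n} (p : Fin n → Bool) → count p ≡ sum (indicator ∘ p)
  count≡sum {zero}  p = refl
  count≡sum {suc n} p with p zero
  ... | true  = cong suc (count≡sum (p ∘ suc))
  ... | false = count≡sum (p ∘ suc)

  count-cong : ∀ {n} {p q : Fin n → Bool} → (∀ i → p i ≡ q i) → count p ≡ count q
  count-cong {p = p} {q} p≗q =
    trans (count≡sum p) (trans (sum-cong-≗ (cong indicator ∘ p≗q)) (sym (count≡sum q)))

  count-↑ : ∀ m {n} (p : Fin (m + n) → Bool) → count p ≡ count (p ∘ (_↑ˡ n)) + count (p ∘ (m ↑ʳ_))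
  count-↑ m {n} p = begin
    count p                                                  ≡⟨ count≡sum p ⟩
    sum (indicator ∘ p)                                      ≡⟨ sum-↑ m (indicator ∘ p) ⟩
    sum (indicator ∘ p ∘ (_↑ˡ n)) + sum (indicator ∘ p ∘ (m ↑ʳ_))
      ≡⟨ cong₂ _+_ (count≡sum (p ∘ (_↑ˡ n))) (count≡sum (p ∘ (m ↑ʳ_))) ⟨
    count (p ∘ (_↑ˡ n)) + count (p ∘ (m ↑ʳ_))              ∎
    where open ≡-Reasoning

  ∑degX≡∑degY : ∀ {a b} (G : BipGraph a b) → sum (degX G) ≡ sum (degY G)
  ∑degX≡∑degY G = begin
    sum (degX G)                                   ≡⟨ sum-cong-≗ (count≡sum ∘ G) ⟩
    sum (λ x → sum (λ y → indicator (G x y)))     ≡⟨ ∑-comm (λ x y → indicator (G x y)) ⟩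
    sum (λ y → sum (λ x → indicator (G x y)))     ≡⟨ sum-cong-≗ (λ y → count≡sum (λ x → G x y)) ⟨
    sum (degY G)                                   ∎
    where open ≡-Reasoning

  deficitX : ∀ {a b} → ℕ → BipGraph a b → Fin a → ℕ
  deficitX d G x = d ∸ degX G x

  deficitY : ∀ {a b} → ℕ → BipGraph a b → Fin b → ℕ
  deficitY d G y = d ∸ degY G y

  ∑deficitY≡∑deficitX : ∀ {n} d (G : BipGraph n n) → (∀ x → degX G x ≤ d) → (∀ y → degY G y ≤ d) →
                        sum (deficitY d G) ≡ sum (deficitX d G)
  ∑deficitY≡∑deficitX {n} d G degX≤d degY≤d = +-cancelʳ-≡ (sum (degY G)) _ _ (begin
    sum (deficitY d G) + sum (degY G)  ≡⟨ ∑[c∸f]+∑f≡n*c (degY G) d degY≤d ⟩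
    n * d                              ≡⟨ ∑[c∸f]+∑f≡n*c (degX G) d degX≤d ⟨
    sum (deficitX d G) + sum (degX G)  ≡⟨ cong (sum (deficitX d G) +_) (∑degX≡∑degY G) ⟩
    sum (deficitX d G) + sum (degY G)  ∎)
    where open ≡-Reasoning

module Residues where
  open import Data.Nat using (_+_; _*_; _∸_; _≤_; _<_; _%_; _≟_)
  open import Data.Nat.Properties
  open import Data.Nat.DivMod using ([m+n]%n≡m%n; m<n⇒m%n≡m; m%n<n)
  open Counting

  countFrom : (ℕ → Bool) → ℕ → ℕ → ℕ
  countFrom p a zero    = 0
  countFrom p a (suc l) = indicator (p a) + countFrom p (suc a) l

  countFrom≡sum : ∀ p a l → countFrom p a l ≡ sum {l} (λ t → indicator (p (a + toℕ t)))
  countFrom≡sum p a zero    = refl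
  countFrom≡sum p a (suc l) =
    cong₂ _+_ (cong (indicator ∘ p) (sym (+-identityʳ a)))
              (trans (countFrom≡sum p (suc a) l)
                     (sum-cong-≗ {l} (λ t → cong (indicator ∘ p) (sym (+-suc a (toℕ t))))))

  countFrom-+ : ∀ p a l₁ l₂ → countFrom p a (l₁ + l₂) ≡ countFrom p a l₁ + countFrom p (a + l₁) l₂
  countFrom-+ p a zero     l₂ = cong (λ b → countFrom p b l₂) (sym (+-identityʳ a))
  countFrom-+ p a (suc l₁) l₂ = begin
    indicator (p a) + countFrom p (suc a) (l₁ + l₂)
      ≡⟨ cong (indicator (p a) +_) (countFrom-+ p (suc a) l₁ l₂) ⟩
    indicator (p a) + (countFrom p (suc a) l₁ + countFrom p (suc a + l₁) l₂)
      ≡⟨ +-assoc (indicator (p a)) _ _ ⟨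
    countFrom p a (suc l₁) + countFrom p (suc a + l₁) l₂
      ≡⟨ cong (λ b → countFrom p a (suc l₁) + countFrom p b l₂) (+-suc a l₁) ⟨
    countFrom p a (suc l₁) + countFrom p (a + suc l₁) l₂ ∎
    where open ≡-Reasoning

  countFrom-mono-≤ : ∀ p a {l₁ l₂} → l₁ ≤ l₂ → countFrom p a l₁ ≤ countFrom p a l₂
  countFrom-mono-≤ p a {l₁} {l₂} l₁≤l₂ = begin
    countFrom p a l₁                                         ≤⟨ m≤m+n _ _ ⟩
    countFrom p a l₁ + countFrom p (a + l₁) (l₂ ∸ l₁)       ≡⟨ countFrom-+ p a l₁ _ ⟨
    countFrom p a (l₁ + (l₂ ∸ l₁))                          ≡⟨ cong (countFrom p a) (m+[n∸m]≡n l₁≤l₂) ⟩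
    countFrom p a l₂                                         ∎
    where open ≤-Reasoning

  countFrom-snoc : ∀ p a l → countFrom p a (suc l) ≡ countFrom p a l + indicator (p (a + l))
  countFrom-snoc p a l = begin
    countFrom p a (suc l)                       ≡⟨ cong (countFrom p a) (+-comm 1 l) ⟩
    countFrom p a (l + 1)                       ≡⟨ countFrom-+ p a l 1 ⟩
    countFrom p a l + (indicator (p (a + l)) + 0) ≡⟨ cong (countFrom p a l +_) (+-identityʳ _) ⟩
    countFrom p a l + indicator (p (a + l))     ∎
    where open ≡-Reasoning

  countFrom-shift : ∀ p l → (∀ j → p (j + l) ≡ p j) → ∀ a → countFrom p (suc a) l ≡ countFrom p a l
  countFrom-shift p zero    periodic a = refl
  countFrom-shift p (suc l) periodic a = begin
    countFrom p (suc a) (suc l)                        ≡⟨ countFrom-snoc p (suc a) l ⟩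
    countFrom p (suc a) l + indicator (p (suc a + l))
      ≡⟨ cong (λ j → countFrom p (suc a) l + indicator (p j)) (+-suc a l) ⟨
    countFrom p (suc a) l + indicator (p (a + suc l))  ≡⟨ cong (λ b → countFrom p (suc a) l + indicator b) (periodic a) ⟩
    countFrom p (suc a) l + indicator (p a)            ≡⟨ +-comm _ (indicator (p a)) ⟩
    countFrom p a (suc l)                              ∎
    where open ≡-Reasoning

  countFrom-periodic : ∀ p l → (∀ j → p (j + l) ≡ p j) → ∀ a → countFrom p a l ≡ countFrom p 0 l
  countFrom-periodic p l periodic zero    = refl
  countFrom-periodic p l periodic (suc a) =
    trans (countFrom-shift p l periodic a) (countFrom-periodic p l periodic a)

  does-≟-sym : ∀ m n → does (m ≟ n) ≡ does (n ≟ m)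
  does-≟-sym m n with m ≟ n
  ... | yes m≡n = trans (dec-true (m ≟ n) m≡n) (sym (dec-true (n ≟ m) (sym m≡n)))
  ... | no  m≢n = trans (dec-false (m ≟ n) m≢n) (sym (dec-false (n ≟ m) (m≢n ∘ sym)))

  ∑[toℕ≟m]≡1 : ∀ {n} m → m < n → sum {n} (λ t → indicator (does (toℕ t ≟ m))) ≡ 1
  ∑[toℕ≟m]≡1 {suc n} zero    _         = cong suc (trans (sum-const n 0) (*-zeroʳ n))
  ∑[toℕ≟m]≡1 {suc n} (suc m) (s≤s m<n) = ∑[toℕ≟m]≡1 m m<n

  module _ (k : ℕ) .{{_ : NonZero k}} where

    residue : ℕ → ℕ → Bool
    residue i j = does (j % k ≟ i)

    countFrom-residue-block : ∀ i a → i < k → countFrom (residue i) a k ≡ 1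
    countFrom-residue-block i a i<k = begin
      countFrom (residue i) a k
        ≡⟨ countFrom-periodic (residue i) k (λ j → cong (λ r → does (r ≟ i)) ([m+n]%n≡m%n j k)) a ⟩
      countFrom (residue i) 0 k
        ≡⟨ countFrom≡sum (residue i) 0 k ⟩
      sum {k} (λ t → indicator (residue i (toℕ t)))
        ≡⟨ sum-cong-≗ {k} (λ t → cong (λ r → indicator (does (r ≟ i))) (m<n⇒m%n≡m (toℕ<n t))) ⟩
      sum {k} (λ t → indicator (does (toℕ t ≟ i)))
        ≡⟨ ∑[toℕ≟m]≡1 i i<k ⟩
      1 ∎
      where open ≡-Reasoning

    countFrom-residue-* : ∀ i a q → i < k → countFrom (residue i) a (k * q) ≡ q
    countFrom-residue-* i a zero    i<k = cong (countFrom (residue i) a) (*-zeroʳ k)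
    countFrom-residue-* i a (suc q) i<k = begin
      countFrom (residue i) a (k * suc q)                                  ≡⟨ cong (countFrom (residue i) a) (*-suc k q) ⟩
      countFrom (residue i) a (k + k * q)                                  ≡⟨ countFrom-+ (residue i) a k (k * q) ⟩
      countFrom (residue i) a k + countFrom (residue i) (a + k) (k * q)    ≡⟨ cong₂ _+_ (countFrom-residue-block i a i<k)
                                                                                         (countFrom-residue-* i (a + k) q i<k) ⟩
      suc q                                                                ∎
      where open ≡-Reasoning

    countFrom-residue-≤1 : ∀ i a l → i < k → l ≤ k → countFrom (residue i) a l ≤ 1
    countFrom-residue-≤1 i a l i<k l≤k =
      subst (countFrom (residue i) a l ≤_) (countFrom-residue-block i a i<k) (countFrom-mono-≤ (residue i) a l≤k)

    ∑countFrom-residue : ∀ a l → sum {k} (λ i → countFrom (residue (toℕ i)) a l) ≡ l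
    ∑countFrom-residue a zero    = trans (sum-const k 0) (*-zeroʳ k)
    ∑countFrom-residue a (suc l) = begin
      sum {k} (λ i → indicator (residue (toℕ i) a) + countFrom (residue (toℕ i)) (suc a) l)
        ≡⟨ ∑-distrib-+ {k} (λ i → indicator (residue (toℕ i) a)) (λ i → countFrom (residue (toℕ i)) (suc a) l) ⟩
      sum {k} (λ i → indicator (does (a % k ≟ toℕ i))) + sum {k} (λ i → countFrom (residue (toℕ i)) (suc a) l)
        ≡⟨ cong₂ _+_ (trans (sum-cong-≗ {k} (λ i → cong indicator (does-≟-sym (a % k) (toℕ i))))
                            (∑[toℕ≟m]≡1 (a % k) (m%n<n a k)))
                     (∑countFrom-residue (suc a) l) ⟩
      suc l ∎
      where open ≡-Reasoning

module CyclicGraph (k : ℕ) .{{_ : NonZero k}} where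
  open import Data.Nat using (_+_; _≤_; _<ᵇ_)
  open Counting
  open Residues

  indicator[0<ᵇc]≡c : ∀ c → c ≤ 1 → indicator (0 <ᵇ c) ≡ c
  indicator[0<ᵇc]≡c zero          _   = refl
  indicator[0<ᵇc]≡c (suc zero)    _   = refl
  indicator[0<ᵇc]≡c (suc (suc c)) (s≤s ())

  hits : ℕ → ℕ → Fin k → Bool
  hits s l i = 0 <ᵇ countFrom (residue k (toℕ i)) s l

  indicator-hits : ∀ s l i → l ≤ k → indicator (hits s l i) ≡ countFrom (residue k (toℕ i)) s l
  indicator-hits s l i l≤k = indicator[0<ᵇc]≡c _ (countFrom-residue-≤1 k (toℕ i) s l (toℕ<n i) l≤k)

  count-hits : ∀ s l → l ≤ k → count (hits s l) ≡ l
  count-hits s l l≤k = begin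
    count (hits s l)                                   ≡⟨ count≡sum (hits s l) ⟩
    sum (indicator ∘ hits s l)                         ≡⟨ sum-cong-≗ {k} (λ i → indicator-hits s l i l≤k) ⟩
    sum {k} (λ i → countFrom (residue k (toℕ i)) s l)  ≡⟨ ∑countFrom-residue k s l ⟩
    l                                                  ∎
    where open ≡-Reasoning

  -- Row x occupies the w x consecutive slots starting at s + w 0 + ⋯ + w (x - 1) and is
  -- joined to the residues mod k of its slots.
  cyclic : ∀ {N} → (Fin N → ℕ) → ℕ → BipGraph N k
  cyclic {suc N} w s zero    = hits s (w zero)
  cyclic {suc N} w s (suc x) = cyclic (w ∘ suc) (s + w zero) x

  degX-cyclic : ∀ {N} (w : Fin N → ℕ) s → (∀ x → w x ≤ k) → ∀ x → degX (cyclic w s) x ≡ w x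
  degX-cyclic {suc N} w s w≤k zero    = count-hits s (w zero) (w≤k zero)
  degX-cyclic {suc N} w s w≤k (suc x) = degX-cyclic (w ∘ suc) (s + w zero) (w≤k ∘ suc) x

  degY-cyclic : ∀ {N} (w : Fin N → ℕ) s → (∀ x → w x ≤ k) →
                ∀ i → degY (cyclic w s) i ≡ countFrom (residue k (toℕ i)) s (sum w)
  degY-cyclic {zero}  w s w≤k i = refl
  degY-cyclic {suc N} w s w≤k i = begin
    degY (cyclic w s) i
      ≡⟨ count≡sum (λ x → cyclic w s x i) ⟩
    indicator (hits s (w zero) i) + sum (λ x → indicator (cyclic (w ∘ suc) (s + w zero) x i))
      ≡⟨ cong₂ _+_ (indicator-hits s (w zero) i (w≤k zero))
                   (trans (sym (count≡sum (λ x → cyclic (w ∘ suc) (s + w zero) x i)))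
                          (degY-cyclic (w ∘ suc) (s + w zero) (w≤k ∘ suc) i)) ⟩
    countFrom (residue k (toℕ i)) s (w zero) + countFrom (residue k (toℕ i)) (s + w zero) (sum (w ∘ suc))
      ≡⟨ countFrom-+ (residue k (toℕ i)) s (w zero) _ ⟨
    countFrom (residue k (toℕ i)) s (sum w) ∎
    where open ≡-Reasoning

module BlockGraph where
  open import Data.Nat using (_+_)
  open Counting

  glue : ∀ {a b c e} → (Fin a ⊎ Fin b → Fin c ⊎ Fin e → Bool) → BipGraph (a + b) (c + e)
  glue {a} {c = c} H x y = H (splitAt a x) (splitAt c y)

  module _ {a b c e} (H : Fin a ⊎ Fin b → Fin c ⊎ Fin e → Bool) where

    degX-glue : ∀ x → degX (glue H) x ≡ count (H (splitAt a x) ∘ inj₁) + count (H (splitAt a x) ∘ inj₂)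
    degX-glue x = trans (count-↑ c (glue H x))
      (cong₂ _+_ (count-cong (λ y → cong (H (splitAt a x)) (splitAt-↑ˡ c y e)))
                 (count-cong (λ y → cong (H (splitAt a x)) (splitAt-↑ʳ c e y))))

    degY-glue : ∀ y → degY (glue H) y ≡ count (λ x → H (inj₁ x) (splitAt c y)) + count (λ x → H (inj₂ x) (splitAt c y))
    degY-glue y = trans (count-↑ a (λ x → glue H x y))
      (cong₂ _+_ (count-cong (λ x → cong (λ u → H u (splitAt c y)) (splitAt-↑ˡ a x b)))
                 (count-cong (λ x → cong (λ u → H u (splitAt c y)) (splitAt-↑ʳ a b x))))

    glue-regular : ∀ d → (∀ u → count (H u ∘ inj₁) + count (H u ∘ inj₂) ≡ d) →
                   (∀ v → count (λ x → H (inj₁ x) v) + count (λ x → H (inj₂ x) v) ≡ d) →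
                   IsDRegular d (glue H)
    glue-regular d rows cols = (λ x → trans (degX-glue x) (rows (splitAt a x)))
                             , (λ y → trans (degY-glue y) (cols (splitAt c y)))

  ∉-image-↑ˡ : ∀ {n k} (z : Fin (n + k)) {i} → splitAt n z ≡ inj₂ i → ¬ (Σ (Fin n) λ x → x ↑ˡ k ≡ z)
  ∉-image-↑ˡ {n} {k} z z-new (x , refl) with trans (sym (splitAt-↑ˡ n x k)) z-new
  ... | ()

  glue-contains : ∀ {n k} (G : BipGraph n n) (H : Fin n ⊎ Fin k → Fin n ⊎ Fin k → Bool) →
                  (∀ x y → H (inj₁ x) (inj₁ y) ≡ G x y) →
                  ContainedWithNewEdgesOutside G (glue H) (_↑ˡ k) (_↑ˡ k)
  glue-contains {n} {k} G H H≡G = ↑ˡ-injective k _ _ , ↑ˡ-injective k _ _ , old-edges , new-edges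
    where
    old-edges : ∀ x y → G x y ≡ true → glue H (x ↑ˡ k) (y ↑ˡ k) ≡ true
    old-edges x y Gxy = begin
      H (splitAt n (x ↑ˡ k)) (splitAt n (y ↑ˡ k))  ≡⟨ cong₂ H (splitAt-↑ˡ n x k) (splitAt-↑ˡ n y k) ⟩
      H (inj₁ x) (inj₁ y)                          ≡⟨ H≡G x y ⟩
      G x y                                        ≡⟨ Gxy ⟩
      true                                         ∎
      where open ≡-Reasoning

    new-edges : ∀ x' y' → glue H x' y' ≡ true →
                ¬ (Σ (Fin n) λ x → Σ (Fin n) λ y → (x ↑ˡ k ≡ x') × (y ↑ˡ k ≡ y') × (G x y ≡ true)) →
                (¬ (Σ (Fin n) λ x → x ↑ˡ k ≡ x')) ⊎ (¬ (Σ (Fin n) λ y → y ↑ˡ k ≡ y'))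
    new-edges x' y' edge not-old with splitAt n x' in x'-part | splitAt n y' in y'-part
    ... | inj₁ x | inj₁ y =
      ⊥-elim (not-old (x , y , splitAt⁻¹-↑ˡ x'-part , splitAt⁻¹-↑ˡ y'-part , trans (sym (H≡G x y)) edge))
    ... | inj₁ _ | inj₂ _ = inj₂ (∉-image-↑ˡ y' y'-part)
    ... | inj₂ _ | _      = inj₁ (∉-image-↑ˡ x' x'-part)

module Extension where
  open import Data.Nat using (_+_; _*_; _∸_; _≤_)
  open import Data.Nat.Properties
  open Counting
  open Residues
  open BlockGraph

  extend-to-regular : ∀ {n} (G : BipGraph n n) d k .{{_ : NonZero k}} →
    (∀ x → degX G x ≤ d) → (∀ y → degY G y ≤ d) →
    (∀ x → deficitX d G x ≤ k) → (∀ y → deficitY d G y ≤ k) →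
    k * (d ∸ k) ≤ sum (deficitX d G) → sum (deficitX d G) ≤ k * d →
    Σ (BipGraph (n + k) (n + k)) λ G' → IsDRegular d G' × ContainedWithNewEdgesOutside G G' (_↑ˡ k) (_↑ˡ k)
  extend-to-regular {n} G d k degX≤d degY≤d rX≤k rY≤k k[d∸k]≤R R≤kd =
    glue H , glue-regular H d rows cols , glue-contains G H (λ _ _ → refl)
    where
    open CyclicGraph k

    rX = deficitX d G
    rY = deficitY d G
    R  = sum rX

    slots : ℕ → ℕ → Fin k → ℕ
    slots a l j = countFrom (residue k (toℕ j)) a l

    degOld : Fin k → ℕ
    degOld = slots 0 R

    degNew : Fin k → ℕ
    degNew i = d ∸ degOld i

    H : Fin n ⊎ Fin k → Fin n ⊎ Fin k → Bool
    H (inj₁ x) (inj₁ y) = G x y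
    H (inj₁ x) (inj₂ j) = cyclic rX 0 x j
    H (inj₂ i) (inj₁ y) = cyclic rY 0 y i
    H (inj₂ i) (inj₂ j) = cyclic degNew R i j

    slots-multiple : ∀ a q j → slots a (k * q) j ≡ q
    slots-multiple a q j = countFrom-residue-* k (toℕ j) a q (toℕ<n j)

    degOld≤d : ∀ i → degOld i ≤ d
    degOld≤d i = subst (degOld i ≤_) (slots-multiple 0 d i) (countFrom-mono-≤ _ 0 R≤kd)

    d∸k≤degOld : ∀ i → d ∸ k ≤ degOld i
    d∸k≤degOld i = subst (_≤ degOld i) (slots-multiple 0 (d ∸ k) i) (countFrom-mono-≤ _ 0 k[d∸k]≤R)

    degNew≤k : ∀ i → degNew i ≤ k
    degNew≤k i = m≤n+o⇒m∸n≤o d (degOld i) (begin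
      d                ≤⟨ m≤n+m∸n d k ⟩
      k + (d ∸ k)      ≤⟨ +-monoʳ-≤ k (d∸k≤degOld i) ⟩
      k + degOld i     ≡⟨ +-comm k (degOld i) ⟩
      degOld i + k     ∎)
      where open ≤-Reasoning

    R+∑degNew≡kd : R + sum degNew ≡ k * d
    R+∑degNew≡kd = begin
      R + sum degNew           ≡⟨ +-comm R (sum degNew) ⟩
      sum degNew + R           ≡⟨ cong (sum degNew +_) (∑countFrom-residue k 0 R) ⟨
      sum degNew + sum degOld  ≡⟨ ∑[c∸f]+∑f≡n*c degOld d degOld≤d ⟩
      k * d                    ∎
      where open ≡-Reasoning

    degY-cyclic-rY : ∀ i → degY (cyclic rY 0) i ≡ degOld i
    degY-cyclic-rY i = trans (degY-cyclic rY 0 rY≤k i)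
                             (cong (countFrom (residue k (toℕ i)) 0) (∑deficitY≡∑deficitX d G degX≤d degY≤d))

    rows : ∀ u → count (H u ∘ inj₁) + count (H u ∘ inj₂) ≡ d
    rows (inj₁ x) = trans (cong (degX G x +_) (degX-cyclic rX 0 rX≤k x)) (m+[n∸m]≡n (degX≤d x))
    rows (inj₂ i) = trans (cong₂ _+_ (degY-cyclic-rY i) (degX-cyclic degNew R degNew≤k i)) (m+[n∸m]≡n (degOld≤d i))

    cols : ∀ v → count (λ x → H (inj₁ x) v) + count (λ x → H (inj₂ x) v) ≡ d
    cols (inj₁ y) = trans (cong (degY G y +_) (degX-cyclic rY 0 rY≤k y)) (m+[n∸m]≡n (degY≤d y))
    cols (inj₂ j) = begin
      degY (cyclic rX 0) j + degY (cyclic degNew R) j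
        ≡⟨ cong₂ _+_ (degY-cyclic rX 0 rX≤k j) (degY-cyclic degNew R degNew≤k j) ⟩
      slots 0 R j + slots R (sum degNew) j
        ≡⟨ countFrom-+ (residue k (toℕ j)) 0 R (sum degNew) ⟨
      slots 0 (R + sum degNew) j
        ≡⟨ cong (λ l → slots 0 l j) R+∑degNew≡kd ⟩
      slots 0 (k * d) j
        ≡⟨ slots-multiple 0 d j ⟩
      d ∎
      where open ≡-Reasoning

module NatArithmetic where
  open import Data.Nat using (_+_; _*_; _∸_; _≤_; _/_; _%_)
  open import Data.Nat.Properties
  open import Data.Nat.DivMod using (m≡m%n+[m/n]*n; m/n*n≤m; m%n<n)
  open Counting

  ⌈/⌉*d-bounds : ∀ R x → R ≤ (R + x) / suc x * suc x × (R + x) / suc x * suc x ≤ R + x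
  ⌈/⌉*d-bounds R x = +-cancelʳ-≤ x R (k * d) R+x≤kd+x , m/n*n≤m (R + x) d
    where
    d = suc x
    k = (R + x) / d
    R+x≤kd+x : R + x ≤ k * d + x
    R+x≤kd+x = begin
      R + x                   ≡⟨ m≡m%n+[m/n]*n (R + x) d ⟩
      (R + x) % d + k * d     ≤⟨ +-monoˡ-≤ (k * d) (≤-pred (m%n<n (R + x) d)) ⟩
      x + k * d               ≡⟨ +-comm x (k * d) ⟩
      k * d + x               ∎
      where open ≤-Reasoning

  k*[d∸k]≤R : ∀ R x k → k * suc x ≤ R + x → suc x ≤ k * k → k * (suc x ∸ k) ≤ R
  k*[d∸k]≤R R x k kd≤R+x d≤k² = begin
    k * (suc x ∸ k)        ≡⟨ *-distribˡ-∸ k (suc x) k ⟩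
    k * suc x ∸ k * k      ≤⟨ m≤n+o⇒m∸n≤o (k * suc x) (k * k) (begin
      k * suc x              ≤⟨ kd≤R+x ⟩
      R + x                  ≤⟨ +-monoʳ-≤ R (≤-trans (n≤1+n x) d≤k²) ⟩
      R + k * k              ≡⟨ +-comm R (k * k) ⟩
      k * k + R              ∎) ⟩
    R                      ∎
    where open ≤-Reasoning

  ≤n*each⇒≤sum : ∀ n .{{_ : NonZero n}} (w : Fin n → ℕ) c → (∀ i → c ≤ n * w i) → c ≤ sum w
  ≤n*each⇒≤sum n w c c≤n*w = *-cancelˡ-≤ n (begin
    n * c                  ≡⟨ sum-const n c ⟨
    sum {n} (λ _ → c)      ≤⟨ sum-mono-≤ c≤n*w ⟩
    sum (λ i → n * w i)    ≡⟨ *-distribˡ-sum n w ⟨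
    n * sum w              ∎)
    where open ≤-Reasoning

module RationalArithmetic where
  import Data.Nat as Nat
  import Data.Nat.Properties as Nat
  open import Data.Integer as ℤ using (+_; -[1+_]; +[1+_]; +0)
  import Data.Integer.Properties as ℤ
  open import Data.Integer.DivMod using (a≡a%n+[a/n]*n; n%d<d)
  open import Data.Integer.Tactic.RingSolver using (solve-∀)
  open import Data.Nat.Coprimality using (Coprime; 1-coprimeTo) renaming (sym to coprime-sym)
  open import Data.Rational
  open import Data.Rational.Properties
  open import Data.Rational.Solver using (module +-*-Solver)
  open +-*-Solver using (solve; _:=_; _:+_; _:-_; :-_)
  open import Data.Unit using (tt)
  open Counting using (sum)

  coprimeTo1 : ∀ a → Coprime a 1
  coprimeTo1 a = coprime-sym (1-coprimeTo a)

  ℕ→ℚ≡mkℚ : ∀ a → ℕ→ℚ a ≡ mkℚ (+ a) 0 (coprimeTo1 a)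
  ℕ→ℚ≡mkℚ a = normalize-coprime (coprimeTo1 a)

  ℕ→ℚ-+ : ∀ a b → ℕ→ℚ (a Nat.+ b) ≡ ℕ→ℚ a + ℕ→ℚ b
  ℕ→ℚ-+ a b = begin
    + (a Nat.+ b) / 1
      ≡⟨ cong (_/ 1) (cong₂ ℤ._+_ (ℤ.*-identityʳ (+ a)) (ℤ.*-identityʳ (+ b))) ⟨
    (+ a ℤ.* + 1 ℤ.+ + b ℤ.* + 1) / 1                ≡⟨⟩
    mkℚ (+ a) 0 (coprimeTo1 a) + mkℚ (+ b) 0 (coprimeTo1 b)  ≡⟨ cong₂ _+_ (ℕ→ℚ≡mkℚ a) (ℕ→ℚ≡mkℚ b) ⟨
    ℕ→ℚ a + ℕ→ℚ b                                    ∎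
    where open ≡-Reasoning

  ℕ→ℚ-* : ∀ a b → ℕ→ℚ (a Nat.* b) ≡ ℕ→ℚ a * ℕ→ℚ b
  ℕ→ℚ-* a b = begin
    + (a Nat.* b) / 1                                ≡⟨ cong (_/ 1) (ℤ.pos-* a b) ⟩
    (+ a ℤ.* + b) / 1                                ≡⟨⟩
    mkℚ (+ a) 0 (coprimeTo1 a) * mkℚ (+ b) 0 (coprimeTo1 b)  ≡⟨ cong₂ _*_ (ℕ→ℚ≡mkℚ a) (ℕ→ℚ≡mkℚ b) ⟨
    ℕ→ℚ a * ℕ→ℚ b                                    ∎
    where open ≡-Reasoning

  ℕ→ℚ-suc-* : ∀ N q → ℕ→ℚ (suc N) * q ≡ q + ℕ→ℚ N * q
  ℕ→ℚ-suc-* N q = begin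
    ℕ→ℚ (suc N) * q          ≡⟨ cong (_* q) (ℕ→ℚ-+ 1 N) ⟩
    (1ℚ + ℕ→ℚ N) * q         ≡⟨ *-distribʳ-+ q 1ℚ (ℕ→ℚ N) ⟩
    1ℚ * q + ℕ→ℚ N * q       ≡⟨ cong (_+ ℕ→ℚ N * q) (*-identityˡ q) ⟩
    q + ℕ→ℚ N * q            ∎
    where open ≡-Reasoning

  ℕ→ℚ-mono-≤ : ∀ {a b} → a Nat.≤ b → ℕ→ℚ a ≤ ℕ→ℚ b
  ℕ→ℚ-mono-≤ {a} {b} a≤b rewrite ℕ→ℚ≡mkℚ a | ℕ→ℚ≡mkℚ b =
    *≤* (subst₂ ℤ._≤_ (sym (ℤ.*-identityʳ (+ a))) (sym (ℤ.*-identityʳ (+ b))) (ℤ.+≤+ a≤b))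

  ℕ→ℚ-cancel-≤ : ∀ {a b} → ℕ→ℚ a ≤ ℕ→ℚ b → a Nat.≤ b
  ℕ→ℚ-cancel-≤ {a} {b} a≤b rewrite ℕ→ℚ≡mkℚ a | ℕ→ℚ≡mkℚ b with a≤b
  ... | *≤* a*1≤b*1 = ℤ.drop‿+≤+ (subst₂ ℤ._≤_ (ℤ.*-identityʳ (+ a)) (ℤ.*-identityʳ (+ b)) a*1≤b*1)

  ℕ→ℚ-nonNeg : ∀ a → 0ℚ ≤ ℕ→ℚ a
  ℕ→ℚ-nonNeg a = ℕ→ℚ-mono-≤ {0} {a} Nat.z≤n

  1/n*n≡1 : ∀ n .{{_ : Nat.NonZero n}} → (+ 1 / n) * ℕ→ℚ n ≡ 1ℚ
  1/n*n≡1 (suc n) rewrite ℕ→ℚ≡mkℚ (suc n) | normalize-coprime {1} {n} (1-coprimeTo (suc n)) =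
    *-inverseˡ (mkℚ (+ suc n) 0 (coprimeTo1 (suc n)))

  -- ceiling p = - floor (- p), and floor divides with a nonnegative remainder r < ↧ p,
  -- so for p = (a+1)/M the division reads a + 1 + r = (x + 1) M.
  ceiling-pos : ∀ p → 0ℚ < p → Σ ℕ λ x → (+ suc x ≡ ceiling p) × (p ≤ ℕ→ℚ (suc x)) × (ℕ→ℚ x < p)
  ceiling-pos (mkℚ +0 m _) (*<* 0<0) = ⊥-elim (ℤ.<-irrefl refl 0<0)
  ceiling-pos (mkℚ -[1+ a ] m _) (*<* ())
  ceiling-pos (mkℚ +[1+ a ] m _) (*<* _)
    with -[1+ a ] ℤ./ + suc m | a≡a%n+[a/n]*n -[1+ a ] (+ suc m) | n%d<d -[1+ a ] (+ suc m)
  ... | + q | division | _ =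
    ⊥-elim (-[1+]≢+ (trans division (trans (cong (λ z → + r ℤ.+ z) (sym (ℤ.pos-* q (suc m)))) (sym (ℤ.pos-+ r _)))))
    where
    r = -[1+ a ] ℤ.% + suc m
    -[1+]≢+ : ∀ {t} → -[1+ a ] ≢ + t
    -[1+]≢+ ()
  ... | -[1+ x ] | division | r<M = x , refl , p≤x+1 , x<p
    where
    M = suc m
    r = -[1+ a ] ℤ.% + M
    a+1+r≡[x+1]M : suc a Nat.+ r ≡ suc x Nat.* M
    a+1+r≡[x+1]M = ℤ.+-injective (begin
      + (suc a Nat.+ r)                                   ≡⟨ ℤ.pos-+ (suc a) r ⟩
      ℤ.- -[1+ a ] ℤ.+ + r                                ≡⟨ cong (λ z → ℤ.- z ℤ.+ + r) division ⟩
      ℤ.- (+ r ℤ.+ ℤ.- (+ suc x) ℤ.* + M) ℤ.+ + r        ≡⟨ ring-identity (+ r) (+ suc x) (+ M) ⟩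
      + suc x ℤ.* + M                                     ≡⟨ ℤ.pos-* (suc x) M ⟨
      + (suc x Nat.* M)                                   ∎)
      where
      open ≡-Reasoning
      ring-identity : ∀ r y M → ℤ.- (r ℤ.+ ℤ.- y ℤ.* M) ℤ.+ r ≡ y ℤ.* M
      ring-identity = solve-∀
    p≤x+1 : mkℚ +[1+ a ] m _ ≤ ℕ→ℚ (suc x)
    p≤x+1 rewrite ℕ→ℚ≡mkℚ (suc x) = *≤* (subst₂ ℤ._≤_ (ℤ.pos-* (suc a) 1) (ℤ.pos-* (suc x) M)
      (ℤ.+≤+ (subst₂ Nat._≤_ (sym (Nat.*-identityʳ (suc a))) a+1+r≡[x+1]M (Nat.m≤m+n (suc a) r))))
    xM<a+1 : x Nat.* M Nat.< suc a
    xM<a+1 = Nat.+-cancelˡ-< M _ _ (subst (Nat._< M Nat.+ suc a) a+1+r≡[x+1]M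
               (subst (suc a Nat.+ r Nat.<_) (Nat.+-comm (suc a) M) (Nat.+-monoʳ-< (suc a) r<M)))
    x<p : ℕ→ℚ x < mkℚ +[1+ a ] m _
    x<p rewrite ℕ→ℚ≡mkℚ x = *<* (subst₂ ℤ._<_ (ℤ.pos-* x M) (ℤ.pos-* (suc a) 1)
      (ℤ.+<+ (subst (x Nat.* M Nat.<_) (sym (Nat.*-identityʳ (suc a))) xM<a+1)))

  *-monoˡ-≤ : ∀ {c a b} → 0ℚ ≤ c → a ≤ b → c * a ≤ c * b
  *-monoˡ-≤ {c} 0≤c = *-monoˡ-≤-nonNeg c {{nonNegative 0≤c}}

  *-monoʳ-≤ : ∀ {c a b} → 0ℚ ≤ c → a ≤ b → a * c ≤ b * c
  *-monoʳ-≤ {c} 0≤c = *-monoʳ-≤-nonNeg c {{nonNegative 0≤c}}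

  *-mono-≤ : ∀ {a b c e} → 0ℚ ≤ a → 0ℚ ≤ c → a ≤ b → c ≤ e → a * c ≤ b * e
  *-mono-≤ 0≤a 0≤c a≤b c≤e = ≤-trans (*-monoʳ-≤ 0≤c a≤b) (*-monoˡ-≤ (≤-trans 0≤a a≤b) c≤e)

  *-cancelˡ-≤ : ∀ {c a b} → 0ℚ < c → c * a ≤ c * b → a ≤ b
  *-cancelˡ-≤ {c} 0<c = *-cancelˡ-≤-pos c {{positive 0<c}}

  *-nonNeg : ∀ {a b} → 0ℚ ≤ a → 0ℚ ≤ b → 0ℚ ≤ a * b
  *-nonNeg {a} {b} 0≤a 0≤b = subst (_≤ a * b) (*-zeroʳ a) (*-monoˡ-≤ 0≤a 0≤b)

  *-pos : ∀ {a b} → 0ℚ < a → 0ℚ < b → 0ℚ < a * b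
  *-pos {a} {b} 0<a 0<b = subst (_< a * b) (*-zeroʳ a) (*-monoʳ-<-pos a {{positive 0<a}} 0<b)

  +-cancelʳ-≤ : ∀ {a b} c → a + c ≤ b + c → a ≤ b
  +-cancelʳ-≤ {a} {b} c a+c≤b+c = subst₂ _≤_ (a+c-c≡a a c) (a+c-c≡a b c) (+-monoˡ-≤ (- c) a+c≤b+c)
    where
    a+c-c≡a : ∀ a c → a + c - c ≡ a
    a+c-c≡a = solve 2 (λ a c → a :+ c :- c := a) refl

  a-b≤c⇒a≤b+c : ∀ {a b c} → a - b ≤ c → a ≤ b + c
  a-b≤c⇒a≤b+c {a} {b} {c} a-b≤c = subst₂ _≤_ (a-b+b≡a a b) (+-comm c b) (+-monoˡ-≤ b a-b≤c)
    where
    a-b+b≡a : ∀ a b → a - b + b ≡ a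
    a-b+b≡a = solve 2 (λ a b → a :- b :+ b := a) refl

  p≤∣p∣ : ∀ p → p ≤ ∣ p ∣
  p≤∣p∣ p with ∣p∣≡p∨∣p∣≡-p p
  ... | inj₁ ∣p∣≡p  = ≤-reflexive (sym ∣p∣≡p)
  ... | inj₂ ∣p∣≡-p = ≤-trans (subst (_≤ 0ℚ) (neg-involutive p) (neg-antimono-≤ 0≤-p)) (0≤∣p∣ p)
    where
    0≤-p : 0ℚ ≤ - p
    0≤-p = subst (0ℚ ≤_) ∣p∣≡-p (0≤∣p∣ p)
    neg-involutive : ∀ p → - - p ≡ p
    neg-involutive = solve 1 (λ p → :- :- p := p) refl

  ≈±⇒≤+ : ∀ {a b c} → a ≈ b ± c → a ≤ b + c
  ≈±⇒≤+ {a} {b} a≈b±c = a-b≤c⇒a≤b+c (≤-trans (p≤∣p∣ (a - b)) a≈b±c)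

  ≈±⇒≥- : ∀ {a b c} → a ≈ b ± c → b ≤ a + c
  ≈±⇒≥- {a} {b} a≈b±c = a-b≤c⇒a≤b+c (≤-trans (p≤∣p∣ (b - a)) (subst (_≤ _) (∣a-b∣≡∣b-a∣ a b) a≈b±c))
    where
    -[a-b]≡b-a : ∀ a b → - (a - b) ≡ b - a
    -[a-b]≡b-a = solve 2 (λ a b → :- (a :- b) := b :- a) refl
    ∣a-b∣≡∣b-a∣ : ∀ a b → ∣ a - b ∣ ≡ ∣ b - a ∣
    ∣a-b∣≡∣b-a∣ a b = trans (sym (∣-p∣≡∣p∣ (a - b))) (cong ∣_∣ (-[a-b]≡b-a a b))

  ^ℚ-nonNeg : ∀ {q} → 0ℚ ≤ q → ∀ j → 0ℚ ≤ q ^ℚ j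
  ^ℚ-nonNeg 0≤q zero    = ≤ᵇ⇒≤ tt
  ^ℚ-nonNeg 0≤q (suc j) = *-nonNeg 0≤q (^ℚ-nonNeg 0≤q j)

  ^ℚ≤1 : ∀ {q} → 0ℚ ≤ q → q ≤ 1ℚ → ∀ j → q ^ℚ j ≤ 1ℚ
  ^ℚ≤1 0≤q q≤1 zero    = ≤-refl
  ^ℚ≤1 {q} 0≤q q≤1 (suc j) =
    subst (q ^ℚ suc j ≤_) (*-identityˡ 1ℚ) (*-mono-≤ 0≤q (^ℚ-nonNeg 0≤q j) q≤1 (^ℚ≤1 0≤q q≤1 j))

  ^ℚ-antimono : ∀ {q} → 0ℚ ≤ q → q ≤ 1ℚ → ∀ i j → q ^ℚ (i Nat.+ j) ≤ q ^ℚ i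
  ^ℚ-antimono 0≤q q≤1 zero    j = ^ℚ≤1 0≤q q≤1 j
  ^ℚ-antimono 0≤q q≤1 (suc i) j = *-monoˡ-≤ 0≤q (^ℚ-antimono 0≤q q≤1 i j)

  ℕ→ℚ-sum-≥ : ∀ {N} (w : Fin N → ℕ) q → (∀ i → q ≤ ℕ→ℚ (w i)) → ℕ→ℚ N * q ≤ ℕ→ℚ (sum w)
  ℕ→ℚ-sum-≥ {zero}  w q q≤w = ≤-reflexive (*-zeroˡ q)
  ℕ→ℚ-sum-≥ {suc N} w q q≤w = subst₂ _≤_ (sym (ℕ→ℚ-suc-* N q)) (sym (ℕ→ℚ-+ (w zero) _))
    (+-mono-≤ (q≤w zero) (ℕ→ℚ-sum-≥ (w ∘ suc) q (q≤w ∘ suc)))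

  ℕ→ℚ-sum-≤ : ∀ {N} (w : Fin N → ℕ) q → (∀ i → ℕ→ℚ (w i) ≤ q) → ℕ→ℚ (sum w) ≤ ℕ→ℚ N * q
  ℕ→ℚ-sum-≤ {zero}  w q w≤q = ≤-reflexive (sym (*-zeroˡ q))
  ℕ→ℚ-sum-≤ {suc N} w q w≤q = subst₂ _≤_ (sym (ℕ→ℚ-+ (w zero) _)) (sym (ℕ→ℚ-suc-* N q))
    (+-mono-≤ (w≤q zero) (ℕ→ℚ-sum-≤ (w ∘ suc) q (w≤q ∘ suc)))

import Data.Nat as Nat
open import Data.Integer using (+_)
open import Data.Rational using (ℚ; _/_; _*_; _+_; _≤_; _<_; 0ℚ; 1ℚ; ceiling)

-- Any constant C ≥ 22 would do: the hypotheses are used only through γ ≤ δ and C ≤ γ²n.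
module Estimates (δ γ : ℚ) (n : ℕ) .{{_ : NonZero n}}
    (0<δ : 0ℚ < δ) (δ≤1/100 : δ ≤ + 1 / 100) (0<γ : 0ℚ < γ) (γ≤1 : γ ≤ 1ℚ)
    (γ≪δ : γ ≪[ 32 ] δ) (1/n≪γ : (+ 1 / n) ≪[ 32 ] γ) where
  import Data.Nat.Properties as Nat
  open import Data.Rational.Properties
    using (positive⁻¹; ≤-trans; <⇒≤; <-≤-trans; ≤ᵇ⇒≤; +-mono-≤; +-monoʳ-≤; +-monoˡ-≤;
           +-assoc; *-assoc; *-comm; *-identityˡ; *-identityʳ; +-identityʳ; module ≤-Reasoning)
  open import Data.Rational.Solver using (module +-*-Solver)
  open +-*-Solver using (solve; _:=_; con; _:+_; _:*_)
  open import Data.Unit using (tt)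
  open RationalArithmetic

  ν A B D : ℚ
  ν = ℕ→ℚ n
  A = δ * ν
  B = γ * A
  D = (1ℚ + ℕ→ℚ 5 * γ) * δ * ν

  0≤γ : 0ℚ ≤ γ
  0≤γ = <⇒≤ 0<γ

  0≤δ : 0ℚ ≤ δ
  0≤δ = <⇒≤ 0<δ

  δ≤1 : δ ≤ 1ℚ
  δ≤1 = ≤-trans δ≤1/100 (≤ᵇ⇒≤ tt)

  0<ν : 0ℚ < ν
  0<ν = <-≤-trans (positive⁻¹ 1ℚ) (ℕ→ℚ-mono-≤ (Nat.>-nonZero⁻¹ n))

  0≤ν : 0ℚ ≤ ν
  0≤ν = <⇒≤ 0<ν

  γ≤δ : γ ≤ δ
  γ≤δ = begin
    γ                 ≡⟨ *-identityˡ γ ⟨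
    1ℚ * γ            ≤⟨ *-monoʳ-≤ 0≤γ (ℕ→ℚ-mono-≤ {1} {32} (Nat.s≤s Nat.z≤n)) ⟩
    ℕ→ℚ 32 * γ        ≤⟨ γ≪δ ⟩
    δ ^ℚ 32           ≤⟨ ^ℚ-antimono 0≤δ δ≤1 1 31 ⟩
    δ * 1ℚ            ≡⟨ *-identityʳ δ ⟩
    δ                 ∎
    where open ≤-Reasoning

  32≤γ²ν : ℕ→ℚ 32 ≤ γ * γ * ν
  32≤γ²ν = begin
    ℕ→ℚ 32                     ≡⟨ *-identityʳ (ℕ→ℚ 32) ⟨
    ℕ→ℚ 32 * 1ℚ                ≡⟨ cong (ℕ→ℚ 32 *_) (1/n*n≡1 n) ⟨
    ℕ→ℚ 32 * ((+ 1 / n) * ν)   ≡⟨ *-assoc (ℕ→ℚ 32) (+ 1 / n) ν ⟨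
    ℕ→ℚ 32 * (+ 1 / n) * ν     ≤⟨ *-monoʳ-≤ 0≤ν (≤-trans 1/n≪γ (^ℚ-antimono 0≤γ γ≤1 2 30)) ⟩
    γ * (γ * 1ℚ) * ν           ≡⟨ cong (λ g → γ * g * ν) (*-identityʳ γ) ⟩
    γ * γ * ν                  ∎
    where open ≤-Reasoning

  γ²ν≤B : γ * γ * ν ≤ B
  γ²ν≤B = subst (_≤ B) (sym (*-assoc γ γ ν)) (*-monoˡ-≤ 0≤γ (*-monoʳ-≤ 0≤ν γ≤δ))

  γ²ν≤γν : γ * γ * ν ≤ γ * ν
  γ²ν≤γν = subst₂ _≤_ (sym (*-assoc γ γ ν)) (*-identityˡ (γ * ν)) (*-monoʳ-≤ (*-nonNeg 0≤γ 0≤ν) γ≤1)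

  1≤B : 1ℚ ≤ B
  1≤B = ≤-trans (ℕ→ℚ-mono-≤ {1} {32} (Nat.s≤s Nat.z≤n)) (≤-trans 32≤γ²ν γ²ν≤B)

  0≤B : 0ℚ ≤ B
  0≤B = ≤-trans (≤ᵇ⇒≤ tt) 1≤B

  0<A : 0ℚ < A
  0<A = *-pos 0<δ 0<ν

  0≤A : 0ℚ ≤ A
  0≤A = <⇒≤ 0<A

  B≤A : B ≤ A
  B≤A = subst (B ≤_) (*-identityˡ A) (*-monoʳ-≤ 0≤A γ≤1)

  1≤A : 1ℚ ≤ A
  1≤A = ≤-trans 1≤B B≤A

  A≤ν : A ≤ ν
  A≤ν = subst (A ≤_) (*-identityˡ ν) (*-monoʳ-≤ 0≤ν δ≤1)

  B≤5B : B ≤ ℕ→ℚ 5 * B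
  B≤5B = subst (_≤ ℕ→ℚ 5 * B) (*-identityˡ B) (*-monoʳ-≤ 0≤B (ℕ→ℚ-mono-≤ {1} {5} (Nat.s≤s Nat.z≤n)))

  D≡A+5B : D ≡ A + ℕ→ℚ 5 * B
  D≡A+5B = distrib (ℕ→ℚ 5) γ δ ν
    where
    distrib : ∀ c g e m → (1ℚ + c * g) * e * m ≡ e * m + c * (g * (e * m))
    distrib = solve 4 (λ c g e m → (con 1ℚ :+ c :* g) :* e :* m := e :* m :+ c :* (g :* (e :* m))) refl

  A≤D : A ≤ D
  A≤D = begin
    A                   ≡⟨ +-identityʳ A ⟨
    A + 0ℚ              ≤⟨ +-monoʳ-≤ A (*-nonNeg (ℕ→ℚ-nonNeg 5) 0≤B) ⟩
    A + ℕ→ℚ 5 * B       ≡⟨ D≡A+5B ⟨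
    D                   ∎
    where open ≤-Reasoning

  ⌈D⌉ : Σ ℕ λ x → (+ suc x ≡ ceiling D) × (D ≤ ℕ→ℚ (suc x)) × (ℕ→ℚ x < D)
  ⌈D⌉ = ceiling-pos D (<-≤-trans 0<A A≤D)

  d-1 d : ℕ
  d-1 = proj₁ ⌈D⌉
  d   = suc d-1

  d≡⌈D⌉ : + d ≡ ceiling D
  d≡⌈D⌉ = proj₁ (proj₂ ⌈D⌉)

  D≤d : D ≤ ℕ→ℚ d
  D≤d = proj₁ (proj₂ (proj₂ ⌈D⌉))

  d≤1+D : ℕ→ℚ d ≤ 1ℚ + D
  d≤1+D = subst (_≤ 1ℚ + D) (sym (ℕ→ℚ-+ 1 d-1)) (+-monoʳ-≤ 1ℚ (<⇒≤ (proj₂ (proj₂ (proj₂ ⌈D⌉)))))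

  7≡5+1+1 : ℕ→ℚ 7 ≡ ℕ→ℚ 5 + 1ℚ + 1ℚ
  7≡5+1+1 = trans (ℕ→ℚ-+ 6 1) (cong (_+ 1ℚ) (ℕ→ℚ-+ 5 1))

  d≤1+A+5B : ℕ→ℚ d ≤ 1ℚ + (A + ℕ→ℚ 5 * B)
  d≤1+A+5B = subst (λ t → ℕ→ℚ d ≤ 1ℚ + t) D≡A+5B d≤1+D

  d≤7A : ℕ→ℚ d ≤ ℕ→ℚ 7 * A
  d≤7A = begin
    ℕ→ℚ d                          ≤⟨ d≤1+A+5B ⟩
    1ℚ + (A + ℕ→ℚ 5 * B)           ≤⟨ +-mono-≤ 1≤A (+-monoʳ-≤ A (*-monoˡ-≤ (ℕ→ℚ-nonNeg 5) B≤A)) ⟩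
    A + (A + ℕ→ℚ 5 * A)            ≡⟨ collect A (ℕ→ℚ 5) ⟩
    (ℕ→ℚ 5 + 1ℚ + 1ℚ) * A          ≡⟨ cong (_* A) 7≡5+1+1 ⟨
    ℕ→ℚ 7 * A                      ∎
    where
    open ≤-Reasoning
    collect : ∀ a c → a + (a + c * a) ≡ (c + 1ℚ + 1ℚ) * a
    collect = solve 2 (λ a c → a :+ (a :+ c :* a) := (c :+ con 1ℚ :+ con 1ℚ) :* a) refl

  module Deficit (e : ℕ) (e≈A : ℕ→ℚ e ≈ A ± B) where

    e≤A+B : ℕ→ℚ e ≤ A + B
    e≤A+B = ≈±⇒≤+ {ℕ→ℚ e} {A} e≈A

    A≤e+B : A ≤ ℕ→ℚ e + B
    A≤e+B = ≈±⇒≥- {ℕ→ℚ e} {A} e≈A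

    e≤d : e Nat.≤ d
    e≤d = ℕ→ℚ-cancel-≤ (begin
      ℕ→ℚ e              ≤⟨ e≤A+B ⟩
      A + B              ≤⟨ +-monoʳ-≤ A B≤5B ⟩
      A + ℕ→ℚ 5 * B      ≡⟨ D≡A+5B ⟨
      D                  ≤⟨ D≤d ⟩
      ℕ→ℚ d              ∎)
      where open ≤-Reasoning

    r : ℕ
    r = d Nat.∸ e

    r+e≡d : ℕ→ℚ r + ℕ→ℚ e ≡ ℕ→ℚ d
    r+e≡d = trans (sym (ℕ→ℚ-+ r e)) (cong ℕ→ℚ (Nat.m∸n+n≡m e≤d))

    4B≤r : ℕ→ℚ 4 * B ≤ ℕ→ℚ r
    4B≤r = +-cancelʳ-≤ (A + B) (begin
      ℕ→ℚ 4 * B + (A + B)        ≡⟨ collect (ℕ→ℚ 4) A B ⟩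
      A + (ℕ→ℚ 4 + 1ℚ) * B       ≡⟨ cong (λ c → A + c * B) (ℕ→ℚ-+ 4 1) ⟨
      A + ℕ→ℚ 5 * B              ≡⟨ D≡A+5B ⟨
      D                          ≤⟨ D≤d ⟩
      ℕ→ℚ d                      ≡⟨ r+e≡d ⟨
      ℕ→ℚ r + ℕ→ℚ e              ≤⟨ +-monoʳ-≤ (ℕ→ℚ r) e≤A+B ⟩
      ℕ→ℚ r + (A + B)            ∎)
      where
      open ≤-Reasoning
      collect : ∀ c a b → c * b + (a + b) ≡ a + (c + 1ℚ) * b
      collect = solve 3 (λ c a b → c :* b :+ (a :+ b) := a :+ (c :+ con 1ℚ) :* b) refl

    r≤7B : ℕ→ℚ r ≤ ℕ→ℚ 7 * B
    r≤7B = +-cancelʳ-≤ A (begin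
      ℕ→ℚ r + A                          ≤⟨ +-monoʳ-≤ (ℕ→ℚ r) A≤e+B ⟩
      ℕ→ℚ r + (ℕ→ℚ e + B)                ≡⟨ +-assoc (ℕ→ℚ r) (ℕ→ℚ e) B ⟨
      ℕ→ℚ r + ℕ→ℚ e + B                  ≡⟨ cong (_+ B) r+e≡d ⟩
      ℕ→ℚ d + B                          ≤⟨ +-monoˡ-≤ B d≤1+A+5B ⟩
      1ℚ + (A + ℕ→ℚ 5 * B) + B           ≤⟨ +-monoˡ-≤ B (+-monoˡ-≤ (A + ℕ→ℚ 5 * B) 1≤B) ⟩
      B + (A + ℕ→ℚ 5 * B) + B            ≡⟨ collect (ℕ→ℚ 5) A B ⟩
      (ℕ→ℚ 5 + 1ℚ + 1ℚ) * B + A          ≡⟨ cong (λ c → c * B + A) 7≡5+1+1 ⟨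
      ℕ→ℚ 7 * B + A                      ∎)
      where
      open ≤-Reasoning
      collect : ∀ c a b → b + (a + c * b) + b ≡ (c + 1ℚ + 1ℚ) * b + a
      collect = solve 3 (λ c a b → b :+ (a :+ c :* b) :+ b := (c :+ con 1ℚ :+ con 1ℚ) :* b :+ a) refl

  -- The only use of δ ≤ 1/100; 49 δ ≤ 4 would suffice.
  deficit-balanced : ∀ e e' → ℕ→ℚ e ≈ A ± B → ℕ→ℚ e' ≈ A ± B →
                     (d Nat.∸ e) Nat.* d Nat.≤ n Nat.* (d Nat.∸ e')
  deficit-balanced e e' e≈A e'≈A = ℕ→ℚ-cancel-≤ (begin
    ℕ→ℚ ((d Nat.∸ e) Nat.* d)          ≡⟨ ℕ→ℚ-* (d Nat.∸ e) d ⟩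
    ℕ→ℚ (d Nat.∸ e) * ℕ→ℚ d
      ≤⟨ *-mono-≤ (ℕ→ℚ-nonNeg (d Nat.∸ e)) (ℕ→ℚ-nonNeg d) (Deficit.r≤7B e e≈A) d≤7A ⟩
    ℕ→ℚ 7 * B * (ℕ→ℚ 7 * A)            ≡⟨ regroup (ℕ→ℚ 7) γ A ⟩
    B * ((ℕ→ℚ 7 * ℕ→ℚ 7) * A)          ≡⟨ cong (λ c → B * (c * A)) (ℕ→ℚ-* 7 7) ⟨
    B * (ℕ→ℚ 49 * (δ * ν))
      ≤⟨ *-monoˡ-≤ 0≤B (*-monoˡ-≤ (ℕ→ℚ-nonNeg 49) (*-monoʳ-≤ 0≤ν δ≤1/100)) ⟩
    B * (ℕ→ℚ 49 * (+ 1 / 100 * ν))     ≡⟨ cong (B *_) (*-assoc (ℕ→ℚ 49) (+ 1 / 100) ν) ⟨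
    B * (ℕ→ℚ 49 * (+ 1 / 100) * ν)
      ≤⟨ *-monoˡ-≤ 0≤B (*-monoʳ-≤ {ν} {ℕ→ℚ 49 * (+ 1 / 100)} {ℕ→ℚ 4} 0≤ν (≤ᵇ⇒≤ tt)) ⟩
    B * (ℕ→ℚ 4 * ν)                    ≡⟨ swap B (ℕ→ℚ 4) ν ⟩
    ν * (ℕ→ℚ 4 * B)                    ≤⟨ *-monoˡ-≤ 0≤ν (Deficit.4B≤r e' e'≈A) ⟩
    ν * ℕ→ℚ (d Nat.∸ e')               ≡⟨ ℕ→ℚ-* n (d Nat.∸ e') ⟨
    ℕ→ℚ (n Nat.* (d Nat.∸ e'))         ∎)
    where
    open ≤-Reasoning
    regroup : ∀ c g a → c * (g * a) * (c * a) ≡ (g * a) * ((c * c) * a)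
    regroup = solve 3 (λ c g a → c :* (g :* a) :* (c :* a) := (g :* a) :* ((c :* c) :* a)) refl
    swap : ∀ b c m → b * (c * m) ≡ m * (c * b)
    swap = solve 3 (λ b c m → b :* (c :* m) := m :* (c :* b)) refl

  module ForGraph (G : BipGraph n n) (G-reg : IsRegularGDN γ δ n G) where
    open Counting using (sum; deficitX; ∑deficitY≡∑deficitX)
    open NatArithmetic

    degX≈A : ∀ x → ℕ→ℚ (degX G x) ≈ A ± B
    degX≈A = proj₁ (proj₂ (proj₂ (proj₂ G-reg)))

    degY≈A : ∀ y → ℕ→ℚ (degY G y) ≈ A ± B
    degY≈A = proj₂ (proj₂ (proj₂ (proj₂ G-reg)))

    degX≤d : ∀ x → degX G x Nat.≤ d
    degX≤d x = Deficit.e≤d (degX G x) (degX≈A x)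

    degY≤d : ∀ y → degY G y Nat.≤ d
    degY≤d y = Deficit.e≤d (degY G y) (degY≈A y)

    R : ℕ
    R = sum (deficitX d G)

    k : ℕ
    k = (R Nat.+ d-1) Nat./ d

    R≤kd : R Nat.≤ k Nat.* d
    R≤kd = proj₁ (⌈/⌉*d-bounds R d-1)

    kd≤R+d-1 : k Nat.* d Nat.≤ R Nat.+ d-1
    kd≤R+d-1 = proj₂ (⌈/⌉*d-bounds R d-1)

    deficit≤k : (deg : Fin n → ℕ) → (∀ i → ℕ→ℚ (deg i) ≈ A ± B) →
                sum (λ i → d Nat.∸ deg i) Nat.≤ k Nat.* d → ∀ i → d Nat.∸ deg i Nat.≤ k
    deficit≤k deg deg≈A ∑≤kd i = Nat.*-cancelʳ-≤ (d Nat.∸ deg i) k d (Nat.≤-trans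
      (≤n*each⇒≤sum n (λ j → d Nat.∸ deg j) _ (λ j → deficit-balanced (deg i) (deg j) (deg≈A i) (deg≈A j)))
      ∑≤kd)

    deficitX≤k : ∀ x → d Nat.∸ degX G x Nat.≤ k
    deficitX≤k = deficit≤k (degX G) degX≈A R≤kd

    deficitY≤k : ∀ y → d Nat.∸ degY G y Nat.≤ k
    deficitY≤k = deficit≤k (degY G) degY≈A
      (subst (Nat._≤ k Nat.* d) (sym (∑deficitY≡∑deficitX d G degX≤d degY≤d)) R≤kd)

    ν4B≤R : ν * (ℕ→ℚ 4 * B) ≤ ℕ→ℚ R
    ν4B≤R = ℕ→ℚ-sum-≥ (deficitX d G) _ (λ x → Deficit.4B≤r (degX G x) (degX≈A x))

    R≤ν7B : ℕ→ℚ R ≤ ν * (ℕ→ℚ 7 * B)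
    R≤ν7B = ℕ→ℚ-sum-≤ (deficitX d G) _ (λ x → Deficit.r≤7B (degX G x) (degX≈A x))

    4γν≤7k : ℕ→ℚ 4 * γ * ν ≤ ℕ→ℚ 7 * ℕ→ℚ k
    4γν≤7k = *-cancelˡ-≤ 0<A (begin
      A * (ℕ→ℚ 4 * γ * ν)       ≡⟨ regroup δ γ ν (ℕ→ℚ 4) ⟩
      ν * (ℕ→ℚ 4 * B)           ≤⟨ ν4B≤R ⟩
      ℕ→ℚ R                     ≤⟨ ℕ→ℚ-mono-≤ R≤kd ⟩
      ℕ→ℚ (k Nat.* d)           ≡⟨ ℕ→ℚ-* k d ⟩
      ℕ→ℚ k * ℕ→ℚ d             ≤⟨ *-monoˡ-≤ (ℕ→ℚ-nonNeg k) d≤7A ⟩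
      ℕ→ℚ k * (ℕ→ℚ 7 * A)       ≡⟨ swap (ℕ→ℚ k) (ℕ→ℚ 7) A ⟩
      A * (ℕ→ℚ 7 * ℕ→ℚ k)       ∎)
      where
      open ≤-Reasoning
      regroup : ∀ e g m c → e * m * (c * g * m) ≡ m * (c * (g * (e * m)))
      regroup = solve 4 (λ e g m c → e :* m :* (c :* g :* m) := m :* (c :* (g :* (e :* m)))) refl
      swap : ∀ a c b → a * (c * b) ≡ b * (c * a)
      swap = solve 3 (λ a c b → a :* (c :* b) := b :* (c :* a)) refl

    d≤k² : d Nat.≤ k Nat.* k
    d≤k² = ℕ→ℚ-cancel-≤ (*-cancelˡ-≤ 0<49 (begin
      ℕ→ℚ 49 * ℕ→ℚ d
        ≤⟨ *-monoˡ-≤ (ℕ→ℚ-nonNeg 49) (≤-trans d≤7A (*-monoˡ-≤ (ℕ→ℚ-nonNeg 7) A≤ν)) ⟩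
      ℕ→ℚ 49 * (ℕ→ℚ 7 * ν)                   ≡⟨ *-assoc (ℕ→ℚ 49) (ℕ→ℚ 7) ν ⟨
      ℕ→ℚ 49 * ℕ→ℚ 7 * ν                     ≡⟨ cong (_* ν) (ℕ→ℚ-* 49 7) ⟨
      ℕ→ℚ 343 * ν                            ≤⟨ *-monoʳ-≤ 0≤ν (ℕ→ℚ-mono-≤ {343} {512} (Nat.≤ᵇ⇒≤ 343 512 tt)) ⟩
      ℕ→ℚ 512 * ν                            ≡⟨ cong (_* ν) (ℕ→ℚ-* 16 32) ⟩
      ℕ→ℚ 16 * ℕ→ℚ 32 * ν                    ≤⟨ *-monoʳ-≤ 0≤ν (*-monoˡ-≤ (ℕ→ℚ-nonNeg 16) 32≤γ²ν) ⟩
      ℕ→ℚ 16 * (γ * γ * ν) * ν               ≡⟨ cong (λ c → c * (γ * γ * ν) * ν) (ℕ→ℚ-* 4 4) ⟩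
      ℕ→ℚ 4 * ℕ→ℚ 4 * (γ * γ * ν) * ν        ≡⟨ square (ℕ→ℚ 4) γ ν ⟩
      (ℕ→ℚ 4 * γ * ν) * (ℕ→ℚ 4 * γ * ν)      ≤⟨ *-mono-≤ 0≤4γν 0≤4γν 4γν≤7k 4γν≤7k ⟩
      (ℕ→ℚ 7 * ℕ→ℚ k) * (ℕ→ℚ 7 * ℕ→ℚ k)      ≡⟨ square′ (ℕ→ℚ 7) (ℕ→ℚ k) ⟩
      ℕ→ℚ 7 * ℕ→ℚ 7 * (ℕ→ℚ k * ℕ→ℚ k)        ≡⟨ cong₂ _*_ (ℕ→ℚ-* 7 7) (ℕ→ℚ-* k k) ⟨
      ℕ→ℚ 49 * ℕ→ℚ (k Nat.* k)               ∎))
      where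
      open ≤-Reasoning
      0<49 : 0ℚ < ℕ→ℚ 49
      0<49 = <-≤-trans (positive⁻¹ 1ℚ) (ℕ→ℚ-mono-≤ {1} {49} (Nat.s≤s Nat.z≤n))
      0≤4γν : 0ℚ ≤ ℕ→ℚ 4 * γ * ν
      0≤4γν = *-nonNeg (*-nonNeg (ℕ→ℚ-nonNeg 4) 0≤γ) 0≤ν
      square : ∀ c g m → c * c * (g * g * m) * m ≡ (c * g * m) * (c * g * m)
      square = solve 3 (λ c g m → c :* c :* (g :* g :* m) :* m := (c :* g :* m) :* (c :* g :* m)) refl
      square′ : ∀ c a → (c * a) * (c * a) ≡ c * c * (a * a)
      square′ = solve 2 (λ c a → (c :* a) :* (c :* a) := c :* c :* (a :* a)) refl

    k-nonZero : Nat.NonZero k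
    k-nonZero = Nat.≢-nonZero (λ k≡0 → d≰0 (subst (λ m → d Nat.≤ m Nat.* m) k≡0 d≤k²))
      where
      d≰0 : ¬ d Nat.≤ 0
      d≰0 ()

    k[d∸k]≤R : k Nat.* (d Nat.∸ k) Nat.≤ R
    k[d∸k]≤R = k*[d∸k]≤R R d-1 k kd≤R+d-1 d≤k²

    k≤7γν+7 : ℕ→ℚ k ≤ ℕ→ℚ 7 * γ * ν + ℕ→ℚ 7
    k≤7γν+7 = *-cancelˡ-≤ 0<A (begin
      A * ℕ→ℚ k                              ≡⟨ *-comm A (ℕ→ℚ k) ⟩
      ℕ→ℚ k * A                              ≤⟨ *-monoˡ-≤ (ℕ→ℚ-nonNeg k) (≤-trans A≤D D≤d) ⟩
      ℕ→ℚ k * ℕ→ℚ d                          ≡⟨ ℕ→ℚ-* k d ⟨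
      ℕ→ℚ (k Nat.* d)                        ≤⟨ ℕ→ℚ-mono-≤ kd≤R+d-1 ⟩
      ℕ→ℚ (R Nat.+ d-1)                      ≡⟨ ℕ→ℚ-+ R d-1 ⟩
      ℕ→ℚ R + ℕ→ℚ d-1                        ≤⟨ +-mono-≤ R≤ν7B (≤-trans (ℕ→ℚ-mono-≤ (Nat.n≤1+n d-1)) d≤7A) ⟩
      ν * (ℕ→ℚ 7 * B) + ℕ→ℚ 7 * A            ≡⟨ factor δ γ ν (ℕ→ℚ 7) ⟩
      A * (ℕ→ℚ 7 * γ * ν + ℕ→ℚ 7)            ∎)
      where
      open ≤-Reasoning
      factor : ∀ e g m c → m * (c * (g * (e * m))) + c * (e * m) ≡ e * m * (c * g * m + c)
      factor = solve 4 (λ e g m c → m :* (c :* (g :* (e :* m))) :+ c :* (e :* m) := e :* m :* (c :* g :* m :+ c)) refl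

    7≤2γν : ℕ→ℚ 7 ≤ ℕ→ℚ 2 * (γ * ν)
    7≤2γν = begin
      ℕ→ℚ 7             ≤⟨ ℕ→ℚ-mono-≤ {7} {64} (Nat.≤ᵇ⇒≤ 7 64 tt) ⟩
      ℕ→ℚ 64            ≡⟨ ℕ→ℚ-* 2 32 ⟩
      ℕ→ℚ 2 * ℕ→ℚ 32    ≤⟨ *-monoˡ-≤ (ℕ→ℚ-nonNeg 2) (≤-trans 32≤γ²ν γ²ν≤γν) ⟩
      ℕ→ℚ 2 * (γ * ν)   ∎
      where open ≤-Reasoning

    n+k≤[1+9γ]n : ℕ→ℚ (n Nat.+ k) ≤ (1ℚ + ℕ→ℚ 9 * γ) * ν
    n+k≤[1+9γ]n = begin
      ℕ→ℚ (n Nat.+ k)                                   ≡⟨ ℕ→ℚ-+ n k ⟩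
      ν + ℕ→ℚ k
        ≤⟨ +-monoʳ-≤ ν (≤-trans k≤7γν+7 (+-monoʳ-≤ (ℕ→ℚ 7 * γ * ν) 7≤2γν)) ⟩
      ν + (ℕ→ℚ 7 * γ * ν + ℕ→ℚ 2 * (γ * ν))             ≡⟨ factor ν γ (ℕ→ℚ 7) (ℕ→ℚ 2) ⟩
      (1ℚ + (ℕ→ℚ 7 + ℕ→ℚ 2) * γ) * ν                    ≡⟨ cong (λ c → (1ℚ + c * γ) * ν) (ℕ→ℚ-+ 7 2) ⟨
      (1ℚ + ℕ→ℚ 9 * γ) * ν                              ∎
      where
      open ≤-Reasoning
      factor : ∀ m g c e → m + (c * g * m + e * (g * m)) ≡ (1ℚ + (c + e) * g) * m
      factor = solve 4 (λ m g c e → m :+ (c :* g :* m :+ e :* (g :* m)) := (con 1ℚ :+ (c :+ e) :* g) :* m) refl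

open Extension using (extend-to-regular)

lemma6p11 : Σ ℕ λ C → (C ≥ 1) × ((δ γ : ℚ) (n : ℕ) .{{_ : NonZero n}} →
              0ℚ < δ → δ ≤ + 1 / 100 → 0ℚ < γ → γ ≤ 1ℚ →
              γ ≪[ C ] δ → (+ 1 / n) ≪[ C ] γ →
              (G : BipGraph n n) → IsRegularGDN γ δ n G →
              Σ ℕ λ m → Σ (BipGraph m m) λ G' → Σ (Fin n → Fin m) λ f → Σ (Fin n → Fin m) λ g →
                Σ ℕ λ d →
                  (+ d ≡ ceiling ((1ℚ + ℕ→ℚ 5 * γ) * δ * ℕ→ℚ n))
                  × (ℕ→ℚ m ≤ (1ℚ + ℕ→ℚ 9 * γ) * ℕ→ℚ n)
                  × IsDRegular d G'
                  × ContainedWithNewEdgesOutside G G' f g)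
lemma6p11 = 32 , s≤s z≤n , λ δ γ n 0<δ δ≤1/100 0<γ γ≤1 γ≪δ 1/n≪γ G G-reg →
  let open Estimates δ γ n 0<δ δ≤1/100 0<γ γ≤1 γ≪δ 1/n≪γ
      open ForGraph G G-reg
      (G' , G'-regular , G⊆G') =
        extend-to-regular G d k {{k-nonZero}} degX≤d degY≤d deficitX≤k deficitY≤k k[d∸k]≤R R≤kd
  in n Nat.+ k , G' , (_↑ˡ k) , (_↑ˡ k) , d , d≡⌈D⌉ , n+k≤[1+9γ]n , G'-regular , G⊆G'
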